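{- Let $\mathcal O\subseteq\mathbb C$ be a subring containing $1$. The image of $\overline M:\overline{\mathrm{FCF}}(\mathcal O)\to\mathrm{SL}_2^\pm(\mathcal O)$ is $\mathbb E_2^\pm(\mathcal O)$, and $\overline M(\overline{\mathrm{FCF}}^{\,+}(\mathcal O))=\mathbb E_2(\mathcal O)$.
   Context: $D(x)=\begin{bmatrix}x&1\\1&0\end{bmatrix}$, $J=\begin{bmatrix}0&1\\1&0\end{bmatrix}$, $U(c)=\begin{bmatrix}1&c\\0&1\end{bmatrix}$, $L(c)=\begin{bmatrix}1&0\\c&1\end{bmatrix}$. $\mathrm{SL}_2^\pm(\mathcal O)$ is the group of matrices in $\mathrm{GL}_2(\mathcal O)$ of determinant $\pm1$; $\mathbb E_2(\mathcal O)$ is the subgroup of $\mathrm{SL}_2(\mathcal O)$ generated by all $L(c),U(c)$, $c\in\mathcal O$; $\mathbb E_2^\pm(\mathcal O)$ is the subgroup of $\mathrm{SL}_2^\pm(\mathcal O)$ generated by all $L(c),U(c)$ and $J$. $\mathrm{FCF}(\mathcal O)$ is the semigroup of finite sequences over $\mathcal O$ under concatenation, $\sim$ the equivalence relation generated by $u[x,0,y]v\sim u[x+y]v$, $\overline{\mathrm{FCF}}(\mathcal O)$ the group of classes, and $\overline{\mathrm{FCF}}^{\,+}(\mathcal O)$ the subgroup of classes of even length. $\overline M$ is the homomorphism induced by $[c_1,\dots,c_n]\mapsto D(c_1)\cdots D(c_n)$. -}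

module Defs where

open import Level using (_⊔_)
open import Algebra.Bundles using (CommutativeRing)
open import Data.List using (List; []; _∷_; _++_; length)
open import Data.Nat using (ℕ)
open import Data.Nat.Base using (_%_)
open import Data.Product using (Σ; _×_; _,_)
open import Data.Sum using (_⊎_)
open import Relation.Binary.PropositionalEquality using (_≡_)

module Theory {c ℓ} (𝒪 : CommutativeRing c ℓ) where
  open CommutativeRing 𝒪 renaming (Carrier to O)

  record Mat2 : Set c where
    constructor mat
    field
      a₁₁ a₁₂ a₂₁ a₂₂ : O
  open Mat2 public

  _≈M_ : Mat2 → Mat2 → Set ℓ
  A ≈M B = (a₁₁ A ≈ a₁₁ B) × (a₁₂ A ≈ a₁₂ B) × (a₂₁ A ≈ a₂₁ B) × (a₂₂ A ≈ a₂₂ B)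

  infixl 7 _·_
  _·_ : Mat2 → Mat2 → Mat2
  A · B = mat (a₁₁ A * a₁₁ B + a₁₂ A * a₂₁ B) (a₁₁ A * a₁₂ B + a₁₂ A * a₂₂ B)
              (a₂₁ A * a₁₁ B + a₂₂ A * a₂₁ B) (a₂₁ A * a₁₂ B + a₂₂ A * a₂₂ B)

  I₂ : Mat2
  I₂ = mat 1# 0# 0# 1#

  det : Mat2 → O
  det A = a₁₁ A * a₂₂ A - a₁₂ A * a₂₁ A

  SL2± : Mat2 → Set ℓ
  SL2± A = (det A ≈ 1#) ⊎ (det A ≈ - 1#)

  SL2 : Mat2 → Set ℓ
  SL2 A = det A ≈ 1#

  D : O → Mat2
  D x = mat x 1# 1# 0#

  J : Mat2
  J = mat 0# 1# 1# 0#

  U : O → Mat2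
  U x = mat 1# x 0# 1#

  L : O → Mat2
  L x = mat 1# 0# x 1#

  data ⟨_⟩ (S : Mat2 → Set (c ⊔ ℓ)) : Mat2 → Set (c ⊔ ℓ) where
    gen  : ∀ {A} → S A → ⟨ S ⟩ A
    one  : ⟨ S ⟩ I₂
    mul  : ∀ {A B} → ⟨ S ⟩ A → ⟨ S ⟩ B → ⟨ S ⟩ (A · B)
    inv  : ∀ {A B} → ⟨ S ⟩ A → (A · B) ≈M I₂ → (B · A) ≈M I₂ → ⟨ S ⟩ B
    resp : ∀ {A B} → ⟨ S ⟩ A → A ≈M B → ⟨ S ⟩ B

  E2gens : Mat2 → Set (c ⊔ ℓ)
  E2gens A = Σ O (λ x → (A ≈M L x) ⊎ (A ≈M U x))

  E2±gens : Mat2 → Set (c ⊔ ℓ)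
  E2±gens A = E2gens A ⊎ (A ≈M J)

  E2 : Mat2 → Set (c ⊔ ℓ)
  E2 = ⟨ E2gens ⟩

  E2± : Mat2 → Set (c ⊔ ℓ)
  E2± = ⟨ E2±gens ⟩

  FCF : Set c
  FCF = List O

  data _⟶_ : FCF → FCF → Set c where
    step : ∀ u x y v → (u ++ x ∷ 0# ∷ y ∷ v) ⟶ (u ++ (x + y) ∷ v)

  data _∼_ : FCF → FCF → Set c where
    ∼-step  : ∀ {s t} → s ⟶ t → s ∼ t
    ∼-refl  : ∀ {s} → s ∼ s
    ∼-sym   : ∀ {s t} → s ∼ t → t ∼ s
    ∼-trans : ∀ {s t u} → s ∼ t → t ∼ u → s ∼ u

  M : FCF → Mat2
  M []       = I₂
  M (x ∷ s) = D x · M s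

  -- M̄ : FCF̄(𝒪) → SL₂^±(𝒪) is M applied to a representative of the class.
  -- The class of s lies in FCF̄⁺ iff it contains a sequence of even length.
  EvenClass : FCF → Set c
  EvenClass s = Σ FCF (λ t → (s ∼ t) × (length t % 2 ≡ 0))

  ImMbar : Mat2 → Set (c ⊔ ℓ)
  ImMbar A = Σ FCF (λ s → M s ≈M A)

  ImMbar⁺ : Mat2 → Set (c ⊔ ℓ)
  ImMbar⁺ A = Σ FCF (λ s → EvenClass s × (M s ≈M A))

-- D(0) = J, D(x) J = U(x) and J D(x) = L(x). Hence D(x) = U(x) J ∈ E₂^± and
-- D(x) D(y) = U(x) L(y) ∈ E₂, while the generators U(x), L(x), J are the images of
-- [x,0], [0,x], [0]. Both images are subgroups, because [0,−x,0] is inverse to [x]: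
-- [0,−x,0,x] ∼ [0,−x+x] and D(0)² = 1. Inverting triples the length, so even lengths
-- survive, and each image contains the subgroup generated by the generators it contains.
module Submission where

open import Defs
open import Algebra.Bundles using (CommutativeRing; Monoid)
open import Function.Bundles using (_⇔_; mk⇔)
open import Data.Product using (_×_; Σ; _,_)
open import Data.Sum using (inj₁; inj₂)
open import Data.Unit using (⊤; tt)
open import Data.List using ([]; _∷_; _++_; [_]; length)
open import Data.List.Properties using (++-assoc)
open import Data.Nat using (_%_)
open import Level using (_⊔_)
open import Relation.Binary.PropositionalEquality as ≡ using (_≡_)
import Algebra.Properties.Monoid as MonoidProperties
import Algebra.Solver.Ring.NaturalCoefficients.Default as Solver
import Relation.Binary.Reasoning.Setoid as SetoidReasoning

module _ {c ℓ} (𝒪 : CommutativeRing c ℓ) where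
  open CommutativeRing 𝒪 renaming (Carrier to O)
  open Theory 𝒪
  open Solver commutativeSemiring using (solve; _:+_; _:*_; _:=_; con)

  1·a+0·b≈a : ∀ a b → 1# * a + 0# * b ≈ a
  1·a+0·b≈a = solve 2 (λ a b → con 1 :* a :+ con 0 :* b := a) refl

  0·a+1·b≈b : ∀ a b → 0# * a + 1# * b ≈ b
  0·a+1·b≈b = solve 2 (λ a b → con 0 :* a :+ con 1 :* b := b) refl

  a·1+b·0≈a : ∀ a b → a * 1# + b * 0# ≈ a
  a·1+b·0≈a = solve 2 (λ a b → a :* con 1 :+ b :* con 0 := a) refl

  a·0+b·1≈b : ∀ a b → a * 0# + b * 1# ≈ b
  a·0+b·1≈b = solve 2 (λ a b → a :* con 0 :+ b :* con 1 := b) refl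

  ·-assoc-entry : ∀ a b e f g h i k →
    (a * e + b * g) * i + (a * f + b * h) * k ≈ a * (e * i + f * k) + b * (g * i + h * k)
  ·-assoc-entry = solve 8 (λ a b e f g h i k →
    (a :* e :+ b :* g) :* i :+ (a :* f :+ b :* h) :* k := a :* (e :* i :+ f :* k) :+ b :* (g :* i :+ h :* k)) refl

  ·-cong : ∀ {A A′ B B′} → A ≈M A′ → B ≈M B′ → (A · B) ≈M (A′ · B′)
  ·-cong (p₁ , p₂ , p₃ , p₄) (q₁ , q₂ , q₃ , q₄) =
    +-cong (*-cong p₁ q₁) (*-cong p₂ q₃) , +-cong (*-cong p₁ q₂) (*-cong p₂ q₄) ,
    +-cong (*-cong p₃ q₁) (*-cong p₄ q₃) , +-cong (*-cong p₃ q₂) (*-cong p₄ q₄)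

  ·-assoc : ∀ A B C → ((A · B) · C) ≈M (A · (B · C))
  ·-assoc (mat a b c d) (mat e f g h) (mat i j k l) =
    ·-assoc-entry a b e f g h i k , ·-assoc-entry a b e f g h j l ,
    ·-assoc-entry c d e f g h i k , ·-assoc-entry c d e f g h j l

  ·-identityˡ : ∀ A → (I₂ · A) ≈M A
  ·-identityˡ (mat a b c d) = 1·a+0·b≈a a c , 1·a+0·b≈a b d , 0·a+1·b≈b a c , 0·a+1·b≈b b d

  ·-identityʳ : ∀ A → (A · I₂) ≈M A
  ·-identityʳ (mat a b c d) = a·1+b·0≈a a b , a·0+b·1≈b a b , a·1+b·0≈a c d , a·0+b·1≈b c d

  Mat2-monoid : Monoid c ℓ
  Mat2-monoid = record
    { Carrier = Mat2
    ; _≈_ = _≈M_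
    ; _∙_ = _·_
    ; ε = I₂
    ; isMonoid = record
      { isSemigroup = record
        { isMagma = record
          { isEquivalence = record
            { refl = refl , refl , refl , refl
            ; sym = λ (p , q , r , s) → sym p , sym q , sym r , sym s
            ; trans = λ (p , q , r , s) (p′ , q′ , r′ , s′) →
                trans p p′ , trans q q′ , trans r r′ , trans s s′
            }
          ; ∙-cong = ·-cong
          }
        ; assoc = ·-assoc
        }
      ; identity = ·-identityˡ , ·-identityʳ
      }
    }

  open Monoid Mat2-monoid using ()
    renaming (setoid to Mat2-setoid; refl to ≈M-refl; sym to ≈M-sym; trans to ≈M-trans; ∙-congˡ to ·-congˡ; ∙-congʳ to ·-congʳ)
  open MonoidProperties Mat2-monoid using (insertˡ; insertʳ; insertᶜ; cancelᶜ)
  open SetoidReasoning Mat2-setoid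

  left-inverse≈right-inverse : ∀ {A B C} → (C · A) ≈M I₂ → (A · B) ≈M I₂ → B ≈M C
  left-inverse≈right-inverse {A} {B} {C} CA≈I AB≈I = begin
    B            ≈⟨ insertˡ CA≈I B ⟩
    C · (A · B)  ≈⟨ ·-congˡ AB≈I ⟩
    C · I₂       ≈⟨ ·-identityʳ C ⟩
    C            ∎

  J·-swaps-rows : ∀ a b c d → (J · mat a b c d) ≈M mat c d a b
  J·-swaps-rows a b c d = 0·a+1·b≈b a c , 0·a+1·b≈b b d , 1·a+0·b≈a a c , 1·a+0·b≈a b d

  ·J-swaps-columns : ∀ a b c d → (mat a b c d · J) ≈M mat b a d c
  ·J-swaps-columns a b c d = a·0+b·1≈b a b , a·1+b·0≈a a b , a·0+b·1≈b c d , a·1+b·0≈a c d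

  J·J≈I : (J · J) ≈M I₂
  J·J≈I = J·-swaps-rows 0# 1# 1# 0#

  D·J≈U : ∀ x → (D x · J) ≈M U x
  D·J≈U x = ·J-swaps-columns x 1# 1# 0#

  J·D≈L : ∀ x → (J · D x) ≈M L x
  J·D≈L x = J·-swaps-rows x 1# 1# 0#

  U·D≈D+ : ∀ x y → (U x · D y) ≈M D (x + y)
  U·D≈D+ x y =
    solve 2 (λ x y → con 1 :* y :+ x :* con 1 := x :+ y) refl x y ,
    a·1+b·0≈a 1# x , 0·a+1·b≈b y 1# , 0·a+1·b≈b 1# 0#

  D·J·D≈D+ : ∀ x y → (D x · (J · D y)) ≈M D (x + y)
  D·J·D≈D+ x y = begin
    D x · (J · D y)  ≈⟨ ≈M-sym (·-assoc (D x) J (D y)) ⟩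
    (D x · J) · D y  ≈⟨ ·-congʳ (D·J≈U x) ⟩
    U x · D y        ≈⟨ U·D≈D+ x y ⟩
    D (x + y)        ∎

  D≈U·J : ∀ x → D x ≈M (U x · J)
  D≈U·J x = ≈M-trans (insertʳ J·J≈I (D x)) (·-congʳ (D·J≈U x))

  D·D≈U·L : ∀ x y → (D x · D y) ≈M (U x · L y)
  D·D≈U·L x y = ≈M-trans (insertᶜ J·J≈I (D x) (D y)) (·-cong (D·J≈U x) (J·D≈L y))

  M-++ : ∀ s t → M (s ++ t) ≈M (M s · M t)
  M-++ []      t = ≈M-sym (·-identityˡ (M t))
  M-++ (x ∷ s) t = begin
    D x · M (s ++ t)   ≈⟨ ·-congˡ (M-++ s t) ⟩
    D x · (M s · M t)  ≈⟨ ≈M-sym (·-assoc (D x) (M s) (M t)) ⟩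
    (D x · M s) · M t  ∎

  M-pair : ∀ x y → M (x ∷ y ∷ []) ≈M (D x · D y)
  M-pair x y = ·-congˡ (·-identityʳ (D y))

  M-⟶ : ∀ {s t} → s ⟶ t → M s ≈M M t
  M-⟶ (step u x y v) = begin
    M (u ++ x ∷ 0# ∷ y ∷ v)          ≈⟨ M-++ u _ ⟩
    M u · (D x · (J · (D y · M v)))  ≈⟨ ·-congˡ (·-congˡ (≈M-sym (·-assoc J (D y) (M v)))) ⟩
    M u · (D x · ((J · D y) · M v))  ≈⟨ ·-congˡ (≈M-sym (·-assoc (D x) (J · D y) (M v))) ⟩
    M u · ((D x · (J · D y)) · M v)  ≈⟨ ·-congˡ (·-congʳ (D·J·D≈D+ x y)) ⟩
    M u · (D (x + y) · M v)          ≈⟨ ≈M-sym (M-++ u _) ⟩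
    M (u ++ (x + y) ∷ v)             ∎

  M-∼ : ∀ {s t} → s ∼ t → M s ≈M M t
  M-∼ (∼-step s⟶t)  = M-⟶ s⟶t
  M-∼ ∼-refl        = ≈M-refl
  M-∼ (∼-sym s∼t)   = ≈M-sym (M-∼ s∼t)
  M-∼ (∼-trans p q) = ≈M-trans (M-∼ p) (M-∼ q)

  inverse-letter : O → FCF
  inverse-letter x = 0# ∷ - x ∷ 0# ∷ []

  inverse : FCF → FCF
  inverse []      = []
  inverse (x ∷ s) = inverse s ++ inverse-letter x

  M-inverse-letter : ∀ x → (M (inverse-letter x) · D x) ≈M I₂
  M-inverse-letter x = begin
    M (inverse-letter x) · D x            ≈⟨ ·-congˡ (≈M-sym (·-identityʳ (D x))) ⟩
    M (inverse-letter x) · M [ x ]        ≈⟨ ≈M-sym (M-++ (inverse-letter x) [ x ]) ⟩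
    M (0# ∷ - x ∷ 0# ∷ x ∷ [])            ≈⟨ M-⟶ (step [ 0# ] (- x) x []) ⟩
    M (0# ∷ (- x + x) ∷ [])               ≈⟨ M-pair 0# (- x + x) ⟩
    J · D (- x + x)                       ≈⟨ ·-congˡ (-‿inverseˡ x , refl , refl , refl) ⟩
    J · J                                 ≈⟨ J·J≈I ⟩
    I₂                                    ∎

  M-inverse : ∀ s → (M (inverse s) · M s) ≈M I₂
  M-inverse []      = ·-identityˡ I₂
  M-inverse (x ∷ s) = begin
    M (inverse s ++ inverse-letter x) · (D x · M s)
      ≈⟨ ·-congʳ (M-++ (inverse s) (inverse-letter x)) ⟩
    (M (inverse s) · M (inverse-letter x)) · (D x · M s)
      ≈⟨ cancelᶜ (M-inverse-letter x) (M (inverse s)) (M s) ⟩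
    M (inverse s) · M s
      ≈⟨ M-inverse s ⟩
    I₂ ∎

  data EvenLength : FCF → Set c where
    []    : EvenLength []
    pair∷ : ∀ {x y t} → EvenLength t → EvenLength (x ∷ y ∷ t)

  EvenLength-++ : ∀ {s t} → EvenLength s → EvenLength t → EvenLength (s ++ t)
  EvenLength-++ []        t = t
  EvenLength-++ (pair∷ s) t = pair∷ (EvenLength-++ s t)

  EvenLength-inverse : ∀ {t} → EvenLength t → EvenLength (inverse t)
  EvenLength-inverse []        = []
  EvenLength-inverse (pair∷ {x} {y} {t} even) =
    ≡.subst EvenLength (≡.sym (++-assoc (inverse t) (inverse-letter y) (inverse-letter x)))
      (EvenLength-++ (EvenLength-inverse even) (pair∷ (pair∷ (pair∷ []))))

  EvenLength⇒%2≡0 : ∀ {t} → EvenLength t → length t % 2 ≡ 0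
  EvenLength⇒%2≡0 []        = ≡.refl
  EvenLength⇒%2≡0 (pair∷ t) = EvenLength⇒%2≡0 t

  %2≡0⇒EvenLength : ∀ t → length t % 2 ≡ 0 → EvenLength t
  %2≡0⇒EvenLength []          _ = []
  %2≡0⇒EvenLength (x ∷ y ∷ t) p = pair∷ (%2≡0⇒EvenLength t p)

  ⟨⟩-minimal : ∀ {t} {S : Mat2 → Set (c ⊔ ℓ)} (T : Mat2 → Set t) →
    (∀ {A B} → T A → A ≈M B → T B) → T I₂ →
    (∀ {A B} → T A → T B → T (A · B)) →
    (∀ {A B} → T A → (A · B) ≈M I₂ → T B) →
    (∀ {A} → S A → T A) →
    ∀ {A} → ⟨ S ⟩ A → T A
  ⟨⟩-minimal T resp-T one-T mul-T inv-T gen-T = go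
    where
    go : ∀ {A} → ⟨ _ ⟩ A → T A
    go (gen SA)       = gen-T SA
    go one            = one-T
    go (mul p q)      = mul-T (go p) (go q)
    go (inv p AB≈I _) = inv-T (go p) AB≈I
    go (resp p A≈B)   = resp-T (go p) A≈B

  Represented : ∀ {p} → (FCF → Set p) → Mat2 → Set (c ⊔ ℓ ⊔ p)
  Represented P A = Σ FCF λ s → P s × (M s ≈M A)

  module _ {p} (P : FCF → Set p) (P-[] : P [])
           (P-++ : ∀ {s t} → P s → P t → P (s ++ t))
           (P-inverse : ∀ {s} → P s → P (inverse s)) where

    ⟨⟩⊆Represented : ∀ {S : Mat2 → Set (c ⊔ ℓ)} → (∀ {A} → S A → Represented P A) →
                     ∀ {A} → ⟨ S ⟩ A → Represented P A
    ⟨⟩⊆Represented = ⟨⟩-minimal (Represented P)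
      (λ (s , Ps , Ms≈A) A≈B → s , Ps , ≈M-trans Ms≈A A≈B)
      ([] , P-[] , ≈M-refl)
      (λ (s , Ps , Ms≈A) (t , Pt , Mt≈B) →
        s ++ t , P-++ Ps Pt , ≈M-trans (M-++ s t) (·-cong Ms≈A Mt≈B))
      (λ (s , Ps , Ms≈A) AB≈I → inverse s , P-inverse Ps ,
        ≈M-sym (left-inverse≈right-inverse (≈M-trans (·-congˡ (≈M-sym Ms≈A)) (M-inverse s)) AB≈I))

  L-represented : ∀ x → M (0# ∷ x ∷ []) ≈M L x
  L-represented x = ≈M-trans (M-pair 0# x) (J·D≈L x)

  U-represented : ∀ x → M (x ∷ 0# ∷ []) ≈M U x
  U-represented x = ≈M-trans (M-pair x 0#) (D·J≈U x)

  M∈E2± : ∀ s → E2± (M s)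
  M∈E2± []      = one
  M∈E2± (x ∷ s) =
    mul (resp (mul (gen (inj₁ (x , inj₂ ≈M-refl))) (gen (inj₂ ≈M-refl))) (≈M-sym (D≈U·J x)))
        (M∈E2± s)

  E2±⊆ImMbar : ∀ {A} → E2± A → ImMbar A
  E2±⊆ImMbar E2±A =
    let (s , _ , Ms≈A) = ⟨⟩⊆Represented (λ _ → ⊤) tt (λ _ _ → tt) (λ _ → tt) generator E2±A
    in s , Ms≈A
    where
    generator : ∀ {A} → E2±gens A → Represented (λ _ → ⊤) A
    generator (inj₁ (x , inj₁ A≈L)) = 0# ∷ x ∷ [] , tt , ≈M-trans (L-represented x) (≈M-sym A≈L)
    generator (inj₁ (x , inj₂ A≈U)) = x ∷ 0# ∷ [] , tt , ≈M-trans (U-represented x) (≈M-sym A≈U)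
    generator (inj₂ A≈J)            = [ 0# ] , tt , ≈M-trans (·-identityʳ J) (≈M-sym A≈J)

  M∈E2 : ∀ {t} → EvenLength t → E2 (M t)
  M∈E2 []          = one
  M∈E2 (pair∷ {x} {y} {t} even) =
    resp (mul (mul (gen (x , inj₂ ≈M-refl)) (gen (y , inj₁ ≈M-refl))) (M∈E2 even)) (begin
      (U x · L y) · M t  ≈⟨ ·-congʳ (≈M-sym (D·D≈U·L x y)) ⟩
      (D x · D y) · M t  ≈⟨ ·-assoc (D x) (D y) (M t) ⟩
      D x · (D y · M t)  ∎)

  E2⊆Represented-EvenLength : ∀ {A} → E2 A → Represented EvenLength A
  E2⊆Represented-EvenLength = ⟨⟩⊆Represented EvenLength [] EvenLength-++ EvenLength-inverse generator
    where
    generator : ∀ {A} → E2gens A → Represented EvenLength A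
    generator (x , inj₁ A≈L) = 0# ∷ x ∷ [] , pair∷ [] , ≈M-trans (L-represented x) (≈M-sym A≈L)
    generator (x , inj₂ A≈U) = x ∷ 0# ∷ [] , pair∷ [] , ≈M-trans (U-represented x) (≈M-sym A≈U)

  ImMbar⇔E2± : ∀ A → ImMbar A ⇔ E2± A
  ImMbar⇔E2± A = mk⇔ (λ (s , Ms≈A) → resp (M∈E2± s) Ms≈A) E2±⊆ImMbar

  ImMbar⁺⊆E2 : ∀ {A} → ImMbar⁺ A → E2 A
  ImMbar⁺⊆E2 (s , (t , s∼t , even) , Ms≈A) =
    resp (M∈E2 (%2≡0⇒EvenLength t even)) (≈M-trans (≈M-sym (M-∼ s∼t)) Ms≈A)

  E2⊆ImMbar⁺ : ∀ {A} → E2 A → ImMbar⁺ A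
  E2⊆ImMbar⁺ E2A = fromRepresented (E2⊆Represented-EvenLength E2A)
    where
    fromRepresented : ∀ {A} → Represented EvenLength A → ImMbar⁺ A
    fromRepresented (t , even , Mt≈A) = t , (t , ∼-refl , EvenLength⇒%2≡0 even) , Mt≈A

  ImMbar⁺⇔E2 : ∀ A → ImMbar⁺ A ⇔ E2 A
  ImMbar⁺⇔E2 A = mk⇔ ImMbar⁺⊆E2 E2⊆ImMbar⁺

proposition3p21 : ∀ {c ℓ} (𝒪 : CommutativeRing c ℓ) →
    let open Theory 𝒪 in
    (∀ A → ImMbar A ⇔ E2± A) × (∀ A → ImMbar⁺ A ⇔ E2 A)
proposition3p21 𝒪 = ImMbar⇔E2± 𝒪 , ImMbar⁺⇔E2 𝒪
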